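{- $\vdash_{\mathcal{R}^{\mathsf{DN}}_\omega\cup\mathcal{R}_{\mathsf{F}}}\;=\;\vdash^{\leq}_{\mathbb{DN}}$.
   Context: Language: binary $\land,\lor$, unary $\neg$, constants $\bot,\top$; $Fm$ is the set of formulas over a countably infinite set of variables. $\mathsf{DN}$ is the set of equations: $x\lor y\approx y\lor x$, $x\land y\approx y\land x$, $x\lor(y\lor z)\approx(x\lor y)\lor z$, $x\land(y\land z)\approx(x\land y)\land z$, $x\lor x\approx x$, $x\land x\approx x$, $x\lor(x\land y)\approx x$, $x\land(x\lor y)\approx x$, $x\land\bot\approx\bot$, $x\lor\top\approx\top$, $x\land(y\lor z)\approx(x\land y)\lor(x\land z)$, $\neg\bot\approx\top$, $\neg(x\lor y)\approx\neg x\land\neg y$; $\mathbb{DN}$ is the variety it axiomatizes (distributive lattices with negation). $\Gamma\vdash^{\leq}_{\mathbb{DN}}\varphi$ iff for every $\mathbf{A}\in\mathbb{DN}$, every non-empty lattice filter $F$ of $\mathbf{A}$ and every homomorphism $h\colon Fm\to A$, $h[\Gamma]\subseteq F$ implies $h(\varphi)\in F$. $\vdash_{\mathcal{R}}$ denotes Hilbert derivability with substitution instances of rules in $\mathcal{R}$. $\mathcal{R}^{\mathsf{DN}}=\{\frac{\varphi}{\psi},\frac{\psi}{\varphi}:\varphi\approx\psi\in\mathsf{DN}\}$. For a set $\mathcal{R}$ of single-premise rules, with fresh variables $q_0,q_1,\dots$ not occurring in $\mathcal{R}$: $\mathcal{R}_0=\mathcal{R}$, $\mathcal{R}_{n+1}=\{\frac{\varphi\lor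 q_n}{\psi\lor q_n},\frac{\varphi\land q_n}{\psi\land q_n},\frac{\neg\psi}{\neg\varphi}:\frac{\varphi}{\psi}\in\mathcal{R}_n\}$, $\mathcal{R}_\omega=\bigcup_n\mathcal{R}_n$; $\mathcal{R}^{\mathsf{DN}}_\omega=(\mathcal{R}^{\mathsf{DN}})_\omega$. $\mathcal{R}_{\mathsf{F}}=\{\frac{}{\top},\frac{p\,,\,q}{p\land q},\frac{p}{p\lor q}\}$. -}

module Defs where

open import Data.Nat using (ℕ; zero; suc; _+_)
open import Data.List using (List; []; _∷_)
open import Data.List.Relation.Unary.All using (All)
open import Data.Product using (Σ; _×_; _,_; ∃)
open import Data.Sum using (_⊎_)
open import Relation.Binary.Structures using (IsEquivalence)

infixr 6 _∧_
infixr 5 _∨_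
infix 7 ¬_

data Fm : Set where
  var   : ℕ → Fm
  _∧_   : Fm → Fm → Fm
  _∨_   : Fm → Fm → Fm
  ¬_    : Fm → Fm
  ⊥     : Fm
  ⊤     : Fm

sub : (ℕ → Fm) → Fm → Fm
sub σ (var n) = σ n
sub σ (a ∧ b) = sub σ a ∧ sub σ b
sub σ (a ∨ b) = sub σ a ∨ sub σ b
sub σ (¬ a)   = ¬ sub σ a
sub σ ⊥       = ⊥
sub σ ⊤       = ⊤

x y z : Fm
x = var 0
y = var 1
z = var 2

data DNEq : Fm → Fm → Set where
  ∨-comm    : DNEq (x ∨ y) (y ∨ x)
  ∧-comm    : DNEq (x ∧ y) (y ∧ x)
  ∨-assoc   : DNEq (x ∨ (y ∨ z)) ((x ∨ y) ∨ z)
  ∧-assoc   : DNEq (x ∧ (y ∧ z)) ((x ∧ y) ∧ z)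
  ∨-idem    : DNEq (x ∨ x) x
  ∧-idem    : DNEq (x ∧ x) x
  ∨-absorb  : DNEq (x ∨ (x ∧ y)) x
  ∧-absorb  : DNEq (x ∧ (x ∨ y)) x
  ∧-bot     : DNEq (x ∧ ⊥) ⊥
  ∨-top     : DNEq (x ∨ ⊤) ⊤
  distrib   : DNEq (x ∧ (y ∨ z)) ((x ∧ y) ∨ (x ∧ z))
  neg-bot   : DNEq (¬ ⊥) ⊤
  neg-join  : DNEq (¬ (x ∨ y)) (¬ x ∧ ¬ y)

record Alg : Set₁ where
  field
    Carrier : Set
    _≈_     : Carrier → Carrier → Set
    isEquivalence : IsEquivalence _≈_
    _⊓_ _⊔_ : Carrier → Carrier → Carrier
    ~_      : Carrier → Carrier
    𝟎 𝟏     : Carrier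
    ⊓-cong  : ∀ {a a′ b b′} → a ≈ a′ → b ≈ b′ → (a ⊓ b) ≈ (a′ ⊓ b′)
    ⊔-cong  : ∀ {a a′ b b′} → a ≈ a′ → b ≈ b′ → (a ⊔ b) ≈ (a′ ⊔ b′)
    ~-cong  : ∀ {a a′} → a ≈ a′ → (~ a) ≈ (~ a′)

module _ (A : Alg) where
  open Alg A

  eval : (ℕ → Carrier) → Fm → Carrier
  eval v (var n) = v n
  eval v (a ∧ b) = eval v a ⊓ eval v b
  eval v (a ∨ b) = eval v a ⊔ eval v b
  eval v (¬ a)   = ~ eval v a
  eval v ⊥       = 𝟎
  eval v ⊤       = 𝟏

  IsDN : Set
  IsDN = ∀ {l r} → DNEq l r → (v : ℕ → Carrier) → eval v l ≈ eval v r

  record IsHom (h : Fm → Carrier) : Set where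
    field
      hom-∧ : ∀ a b → h (a ∧ b) ≈ (h a ⊓ h b)
      hom-∨ : ∀ a b → h (a ∨ b) ≈ (h a ⊔ h b)
      hom-¬ : ∀ a → h (¬ a) ≈ (~ h a)
      hom-⊥ : h ⊥ ≈ 𝟎
      hom-⊤ : h ⊤ ≈ 𝟏

  _≤ᴬ_ : Carrier → Carrier → Set
  a ≤ᴬ b = (a ⊓ b) ≈ a

  record IsFilter (F : Carrier → Set) : Set where
    field
      nonempty : Σ Carrier F
      up       : ∀ {a b} → F a → a ≤ᴬ b → F b
      meet     : ∀ {a b} → F a → F b → F (a ⊓ b)

DNAlg : Set₁
DNAlg = Σ Alg IsDN

_⊢≤DN_ : (Fm → Set) → Fm → Set₁
Γ ⊢≤DN φ = (A : Alg) → IsDN A → (F : Alg.Carrier A → Set) → IsFilter A F →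
           (h : Fm → Alg.Carrier A) → IsHom A h →
           (∀ γ → Γ γ → F (h γ)) → F (h φ)

record Rule : Set where
  constructor _/_
  field
    premises   : List Fm
    conclusion : Fm

data _⊢[_]_ (Γ : Fm → Set) (R : Rule → Set) : Fm → Set where
  hyp : ∀ {φ} → Γ φ → Γ ⊢[ R ] φ
  app : (r : Rule) → R r → (σ : ℕ → Fm) →
        All (λ p → Γ ⊢[ R ] sub σ p) (Rule.premises r) →
        Γ ⊢[ R ] sub σ (Rule.conclusion r)

-- R^DN, and the closure R_ω with fresh variables q_n = var (3 + n)
-- (variables 0,1,2 are the only ones occurring in R^DN).

q : ℕ → Fm
q n = var (3 + n)

-- RDN n φ ψ : the single-premise rule φ/ψ belongs to (R^DN)_n
data RDN : ℕ → Fm → Fm → Set where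
  base-→ : ∀ {l r} → DNEq l r → RDN 0 l r
  base-← : ∀ {l r} → DNEq l r → RDN 0 r l
  step-∨ : ∀ {n φ ψ} → RDN n φ ψ → RDN (suc n) (φ ∨ q n) (ψ ∨ q n)
  step-∧ : ∀ {n φ ψ} → RDN n φ ψ → RDN (suc n) (φ ∧ q n) (ψ ∧ q n)
  step-¬ : ∀ {n φ ψ} → RDN n φ ψ → RDN (suc n) (¬ ψ) (¬ φ)

data R : Rule → Set where
  rdn   : ∀ {n φ ψ} → RDN n φ ψ → R ((φ ∷ []) / ψ)
  r-top : R ([] / ⊤)
  r-and : R ((var 0 ∷ var 1 ∷ []) / (var 0 ∧ var 1))
  r-or  : R ((var 0 ∷ []) / (var 0 ∨ var 1))

-- Soundness: a homomorphism sends the two sides of an instance of a rule of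
-- R^DN_ω to equal elements (the context q_n is added on the same side of both),
-- and R_F says exactly that filters contain ⊤ and are closed under ∧ and
-- upwards.  Completeness: formulas modulo the equivalence generated by
-- instances of R^DN_ω form a DN-algebra; the fresh variables q_n make that
-- equivalence a congruence.  There the Γ-derivable formulas form a filter, and
-- the identity homomorphism refutes every underivable φ.
module Submission where

open import Defs
open import Data.Product using (_×_; _,_; proj₁; proj₂)
open import Data.Nat using (ℕ; zero; suc; _+_; _<_; _≟_; z<s; s<s)
open import Data.Nat.Properties using (<-irrefl; m<n⇒m<1+n; n<1+n)
open import Data.List.Relation.Unary.All using ([]; _∷_)
open import Data.Unit using (tt) renaming (⊤ to Unit)
open import Data.Empty using (⊥-elim)
open import Function using (_∘_; id)
open import Relation.Nullary using (yes; no)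
open import Relation.Binary.Bundles using (Setoid)
open import Relation.Binary.Structures using (IsEquivalence)
open import Relation.Binary.PropositionalEquality as ≡ using (_≡_; subst₂)
open import Relation.Binary.Construct.Closure.ReflexiveTransitive
  using (Star; ε; _◅_; _◅◅_; gmap; reverse; return)

⟨_,_⟩ : {A : Set} → A → A → ℕ → A
⟨ a , b ⟩ zero    = a
⟨ a , b ⟩ (suc _) = b

module DNAlgebra (A : Alg) (isDN : IsDN A) where
  open Alg A
  open IsEquivalence isEquivalence

  private
    setoid : Setoid _ _
    setoid = record { isEquivalence = isEquivalence }

  open import Relation.Binary.Reasoning.Setoid setoid

  _≤_ : Carrier → Carrier → Set
  _≤_ = _≤ᴬ_ A

  ≈⇒≤ : ∀ {a b} → a ≈ b → a ≤ b
  ≈⇒≤ {a} {b} a≈b = begin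
    a ⊓ b  ≈⟨ ⊓-cong refl (sym a≈b) ⟩
    a ⊓ a  ≈⟨ isDN ∧-idem ⟨ a , a ⟩ ⟩
    a      ∎

  x≤x⊔y : ∀ {a b} → a ≤ (a ⊔ b)
  x≤x⊔y {a} {b} = isDN ∧-absorb ⟨ a , b ⟩

  x≤𝟏 : ∀ {a} → a ≤ 𝟏
  x≤𝟏 {a} = begin
    a ⊓ 𝟏        ≈⟨ ⊓-cong refl (sym (isDN ∨-top ⟨ a , 𝟏 ⟩)) ⟩
    a ⊓ (a ⊔ 𝟏)  ≈⟨ x≤x⊔y ⟩
    a            ∎

  module Filter {F : Carrier → Set} (isFilter : IsFilter A F) where
    open IsFilter isFilter

    F-resp-≈ : ∀ {a b} → F a → a ≈ b → F b
    F-resp-≈ Fa a≈b = up Fa (≈⇒≤ a≈b)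

    F-𝟏 : F 𝟏
    F-𝟏 = up (proj₂ nonempty) x≤𝟏

  module Hom {h : Fm → Carrier} (isHom : IsHom A h) where
    open IsHom isHom

    hom-sub : ∀ σ φ → h (sub σ φ) ≈ eval A (h ∘ σ) φ
    hom-sub σ (var i) = refl
    hom-sub σ (a ∧ b) = trans (hom-∧ _ _) (⊓-cong (hom-sub σ a) (hom-sub σ b))
    hom-sub σ (a ∨ b) = trans (hom-∨ _ _) (⊔-cong (hom-sub σ a) (hom-sub σ b))
    hom-sub σ (¬ a)   = trans (hom-¬ _) (~-cong (hom-sub σ a))
    hom-sub σ ⊥       = hom-⊥
    hom-sub σ ⊤       = hom-⊤

    hom-RDN : ∀ {n φ ψ} → RDN n φ ψ → ∀ σ → h (sub σ φ) ≈ h (sub σ ψ)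
    hom-RDN (base-→ {l} {r} e) σ = begin
      h (sub σ l)         ≈⟨ hom-sub σ l ⟩
      eval A (h ∘ σ) l    ≈⟨ isDN e (h ∘ σ) ⟩
      eval A (h ∘ σ) r    ≈⟨ sym (hom-sub σ r) ⟩
      h (sub σ r)         ∎
    hom-RDN (base-← e) σ = sym (hom-RDN (base-→ e) σ)
    hom-RDN (step-∨ r) σ =
      trans (hom-∨ _ _) (trans (⊔-cong (hom-RDN r σ) refl) (sym (hom-∨ _ _)))
    hom-RDN (step-∧ r) σ =
      trans (hom-∧ _ _) (trans (⊓-cong (hom-RDN r σ) refl) (sym (hom-∧ _ _)))
    hom-RDN (step-¬ r) σ =
      trans (hom-¬ _) (trans (~-cong (sym (hom-RDN r σ))) (sym (hom-¬ _)))

  module _ {F : Carrier → Set} (isFilter : IsFilter A F)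
           {h : Fm → Carrier} (isHom : IsHom A h) where
    open Filter isFilter
    open Hom isHom
    open IsFilter isFilter
    open IsHom isHom

    ⊢⇒∈F : ∀ {Γ φ} → (∀ γ → Γ γ → F (h γ)) → Γ ⊢[ R ] φ → F (h φ)
    ⊢⇒∈F hΓ (hyp γ) = hΓ _ γ
    ⊢⇒∈F hΓ (app _ (rdn r) σ (d ∷ [])) = F-resp-≈ (⊢⇒∈F hΓ d) (hom-RDN r σ)
    ⊢⇒∈F hΓ (app _ r-top σ []) = F-resp-≈ F-𝟏 (sym hom-⊤)
    ⊢⇒∈F hΓ (app _ r-and σ (d₁ ∷ d₂ ∷ [])) =
      F-resp-≈ (meet (⊢⇒∈F hΓ d₁) (⊢⇒∈F hΓ d₂)) (sym (hom-∧ _ _))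
    ⊢⇒∈F hΓ (app _ r-or σ (d ∷ [])) =
      F-resp-≈ (up (⊢⇒∈F hΓ d) x≤x⊔y) (sym (hom-∨ _ _))

sound : ∀ {Γ φ} → Γ ⊢[ R ] φ → Γ ⊢≤DN φ
sound d A isDN F isFilter h isHom hΓ = DNAlgebra.⊢⇒∈F A isDN isFilter isHom hΓ d

VarsBelow : ℕ → Fm → Set
VarsBelow k (var i) = i < k
VarsBelow k (a ∧ b) = VarsBelow k a × VarsBelow k b
VarsBelow k (a ∨ b) = VarsBelow k a × VarsBelow k b
VarsBelow k (¬ a)   = VarsBelow k a
VarsBelow k ⊥       = Unit
VarsBelow k ⊤       = Unit

VarsBelow-suc : ∀ {k} φ → VarsBelow k φ → VarsBelow (suc k) φ
VarsBelow-suc (var i) i<k       = m<n⇒m<1+n i<k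
VarsBelow-suc (a ∧ b) (va , vb) = VarsBelow-suc a va , VarsBelow-suc b vb
VarsBelow-suc (a ∨ b) (va , vb) = VarsBelow-suc a va , VarsBelow-suc b vb
VarsBelow-suc (¬ a)   va        = VarsBelow-suc a va
VarsBelow-suc ⊥       _         = tt
VarsBelow-suc ⊤       _         = tt

private
  x₃ : VarsBelow 3 x
  x₃ = z<s
  y₃ : VarsBelow 3 y
  y₃ = s<s z<s
  z₃ : VarsBelow 3 z
  z₃ = s<s (s<s z<s)

DNEq-VarsBelow : ∀ {l r} → DNEq l r → VarsBelow 3 l × VarsBelow 3 r
DNEq-VarsBelow ∨-comm   = (x₃ , y₃) , (y₃ , x₃)
DNEq-VarsBelow ∧-comm   = (x₃ , y₃) , (y₃ , x₃)
DNEq-VarsBelow ∨-assoc  = (x₃ , y₃ , z₃) , ((x₃ , y₃) , z₃)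
DNEq-VarsBelow ∧-assoc  = (x₃ , y₃ , z₃) , ((x₃ , y₃) , z₃)
DNEq-VarsBelow ∨-idem   = (x₃ , x₃) , x₃
DNEq-VarsBelow ∧-idem   = (x₃ , x₃) , x₃
DNEq-VarsBelow ∨-absorb = (x₃ , x₃ , y₃) , x₃
DNEq-VarsBelow ∧-absorb = (x₃ , x₃ , y₃) , x₃
DNEq-VarsBelow ∧-bot    = (x₃ , tt) , tt
DNEq-VarsBelow ∨-top    = (x₃ , tt) , tt
DNEq-VarsBelow distrib  = (x₃ , y₃ , z₃) , ((x₃ , y₃) , (x₃ , z₃))
DNEq-VarsBelow neg-bot  = tt , tt
DNEq-VarsBelow neg-join = (x₃ , y₃) , (x₃ , y₃)

_[_≔_] : (ℕ → Fm) → ℕ → Fm → ℕ → Fm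
(σ [ k ≔ c ]) i with i ≟ k
... | yes _ = c
... | no  _ = σ i

[≔]-here : ∀ σ k c → (σ [ k ≔ c ]) k ≡ c
[≔]-here σ k c with k ≟ k
... | yes _  = ≡.refl
... | no k≢k = ⊥-elim (k≢k ≡.refl)

sub-[≔]-fresh : ∀ {k} σ c φ → VarsBelow k φ → sub (σ [ k ≔ c ]) φ ≡ sub σ φ
sub-[≔]-fresh {k} σ c (var i) i<k with i ≟ k
... | yes ≡.refl = ⊥-elim (<-irrefl ≡.refl i<k)
... | no  _      = ≡.refl
sub-[≔]-fresh σ c (a ∧ b) (va , vb) = ≡.cong₂ _∧_ (sub-[≔]-fresh σ c a va) (sub-[≔]-fresh σ c b vb)
sub-[≔]-fresh σ c (a ∨ b) (va , vb) = ≡.cong₂ _∨_ (sub-[≔]-fresh σ c a va) (sub-[≔]-fresh σ c b vb)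
sub-[≔]-fresh σ c (¬ a)   va        = ≡.cong ¬_ (sub-[≔]-fresh σ c a va)
sub-[≔]-fresh σ c ⊥       _         = ≡.refl
sub-[≔]-fresh σ c ⊤       _         = ≡.refl

RDN-VarsBelow : ∀ {n φ ψ} → RDN n φ ψ → VarsBelow (3 + n) φ × VarsBelow (3 + n) ψ
RDN-VarsBelow (base-→ e) = DNEq-VarsBelow e
RDN-VarsBelow (base-← e) = proj₂ (DNEq-VarsBelow e) , proj₁ (DNEq-VarsBelow e)
RDN-VarsBelow {suc n} (step-∨ {φ = φ} {ψ} r) =
  (VarsBelow-suc φ (proj₁ (RDN-VarsBelow r)) , n<1+n (3 + n)) ,
  (VarsBelow-suc ψ (proj₂ (RDN-VarsBelow r)) , n<1+n (3 + n))
RDN-VarsBelow {suc n} (step-∧ {φ = φ} {ψ} r) =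
  (VarsBelow-suc φ (proj₁ (RDN-VarsBelow r)) , n<1+n (3 + n)) ,
  (VarsBelow-suc ψ (proj₂ (RDN-VarsBelow r)) , n<1+n (3 + n))
RDN-VarsBelow (step-¬ {φ = φ} {ψ} r) =
  VarsBelow-suc ψ (proj₂ (RDN-VarsBelow r)) , VarsBelow-suc φ (proj₁ (RDN-VarsBelow r))

RDN-sym : ∀ {n φ ψ} → RDN n φ ψ → RDN n ψ φ
RDN-sym (base-→ e) = base-← e
RDN-sym (base-← e) = base-→ e
RDN-sym (step-∨ r) = step-∨ (RDN-sym r)
RDN-sym (step-∧ r) = step-∧ (RDN-sym r)
RDN-sym (step-¬ r) = step-¬ (RDN-sym r)

module RDN-sub-fresh {n φ ψ} (r : RDN n φ ψ) (σ : ℕ → Fm) (c : Fm) where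
  φ-fresh : sub (σ [ 3 + n ≔ c ]) φ ≡ sub σ φ
  φ-fresh = sub-[≔]-fresh σ c φ (proj₁ (RDN-VarsBelow r))

  ψ-fresh : sub (σ [ 3 + n ≔ c ]) ψ ≡ sub σ ψ
  ψ-fresh = sub-[≔]-fresh σ c ψ (proj₂ (RDN-VarsBelow r))

data _↝_ : Fm → Fm → Set where
  instanceOf : ∀ {n φ ψ} → RDN n φ ψ → ∀ σ → sub σ φ ↝ sub σ ψ

_≋_ : Fm → Fm → Set
_≋_ = Star _↝_

↝-sym : ∀ {a b} → a ↝ b → b ↝ a
↝-sym (instanceOf r σ) = instanceOf (RDN-sym r) σ

↝-¬ : ∀ {a b} → a ↝ b → (¬ a) ↝ (¬ b)
↝-¬ (instanceOf r σ) = instanceOf (step-¬ (RDN-sym r)) σ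

↝-∨ʳ : ∀ c {a b} → a ↝ b → (a ∨ c) ↝ (b ∨ c)
↝-∨ʳ c (instanceOf {n} {φ} {ψ} r σ) =
  subst₂ _↝_ (≡.cong₂ _∨_ φ-fresh ([≔]-here σ (3 + n) c))
             (≡.cong₂ _∨_ ψ-fresh ([≔]-here σ (3 + n) c))
             (instanceOf (step-∨ r) (σ [ 3 + n ≔ c ]))
  where open RDN-sub-fresh r σ c

↝-∧ʳ : ∀ c {a b} → a ↝ b → (a ∧ c) ↝ (b ∧ c)
↝-∧ʳ c (instanceOf {n} {φ} {ψ} r σ) =
  subst₂ _↝_ (≡.cong₂ _∧_ φ-fresh ([≔]-here σ (3 + n) c))
             (≡.cong₂ _∧_ ψ-fresh ([≔]-here σ (3 + n) c))
             (instanceOf (step-∧ r) (σ [ 3 + n ≔ c ]))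
  where open RDN-sub-fresh r σ c

DN-instance : ∀ {l r} → DNEq l r → ∀ σ → sub σ l ≋ sub σ r
DN-instance e σ = return (instanceOf (base-→ e) σ)

≋-sym : ∀ {a b} → a ≋ b → b ≋ a
≋-sym = reverse ↝-sym

≋-∨ : ∀ {a a′ b b′} → a ≋ a′ → b ≋ b′ → (a ∨ b) ≋ (a′ ∨ b′)
≋-∨ {a′ = a′} {b} {b′} a≋a′ b≋b′ =
  gmap (_∨ b) (↝-∨ʳ b) a≋a′ ◅◅ DN-instance ∨-comm ⟨ a′ , b ⟩ ◅◅
  gmap (_∨ a′) (↝-∨ʳ a′) b≋b′ ◅◅ DN-instance ∨-comm ⟨ b′ , a′ ⟩

≋-∧ : ∀ {a a′ b b′} → a ≋ a′ → b ≋ b′ → (a ∧ b) ≋ (a′ ∧ b′)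
≋-∧ {a′ = a′} {b} {b′} a≋a′ b≋b′ =
  gmap (_∧ b) (↝-∧ʳ b) a≋a′ ◅◅ DN-instance ∧-comm ⟨ a′ , b ⟩ ◅◅
  gmap (_∧ a′) (↝-∧ʳ a′) b≋b′ ◅◅ DN-instance ∧-comm ⟨ b′ , a′ ⟩

≋-¬ : ∀ {a b} → a ≋ b → (¬ a) ≋ (¬ b)
≋-¬ = gmap ¬_ ↝-¬

Lindenbaum : Alg
Lindenbaum = record
  { Carrier       = Fm
  ; _≈_           = _≋_
  ; isEquivalence = record { refl = ε ; sym = ≋-sym ; trans = _◅◅_ }
  ; _⊓_ = _∧_ ; _⊔_ = _∨_ ; ~_ = ¬_ ; 𝟎 = ⊥ ; 𝟏 = ⊤
  ; ⊓-cong = ≋-∧ ; ⊔-cong = ≋-∨ ; ~-cong = ≋-¬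
  }

eval-Lindenbaum : ∀ σ φ → eval Lindenbaum σ φ ≡ sub σ φ
eval-Lindenbaum σ (var i) = ≡.refl
eval-Lindenbaum σ (a ∧ b) = ≡.cong₂ _∧_ (eval-Lindenbaum σ a) (eval-Lindenbaum σ b)
eval-Lindenbaum σ (a ∨ b) = ≡.cong₂ _∨_ (eval-Lindenbaum σ a) (eval-Lindenbaum σ b)
eval-Lindenbaum σ (¬ a)   = ≡.cong ¬_ (eval-Lindenbaum σ a)
eval-Lindenbaum σ ⊥       = ≡.refl
eval-Lindenbaum σ ⊤       = ≡.refl

Lindenbaum-isDN : IsDN Lindenbaum
Lindenbaum-isDN {l} {r} e σ =
  subst₂ _≋_ (≡.sym (eval-Lindenbaum σ l)) (≡.sym (eval-Lindenbaum σ r)) (DN-instance e σ)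

id-isHom : IsHom Lindenbaum id
id-isHom = record
  { hom-∧ = λ _ _ → ε ; hom-∨ = λ _ _ → ε ; hom-¬ = λ _ → ε ; hom-⊥ = ε ; hom-⊤ = ε }

module DerivableFilter (Γ : Fm → Set) where

  ↝-preserves-⊢ : ∀ {a b} → a ↝ b → Γ ⊢[ R ] a → Γ ⊢[ R ] b
  ↝-preserves-⊢ (instanceOf r σ) d = app _ (rdn r) σ (d ∷ [])

  ≋-preserves-⊢ : ∀ {a b} → a ≋ b → Γ ⊢[ R ] a → Γ ⊢[ R ] b
  ≋-preserves-⊢ ε        d = d
  ≋-preserves-⊢ (s ◅ ss) d = ≋-preserves-⊢ ss (↝-preserves-⊢ s d)

  ⊢-∧ : ∀ {a b} → Γ ⊢[ R ] a → Γ ⊢[ R ] b → Γ ⊢[ R ] (a ∧ b)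
  ⊢-∧ {a} {b} da db = app _ r-and ⟨ a , b ⟩ (da ∷ db ∷ [])

  ⊢-∨ : ∀ {a} b → Γ ⊢[ R ] a → Γ ⊢[ R ] (a ∨ b)
  ⊢-∨ {a} b da = app _ r-or ⟨ a , b ⟩ (da ∷ [])

  -- a ⊢ b ∧ a ⊢ (b ∧ a) ∨ b ⊢ b
  ⊢-up : ∀ {a b} → Γ ⊢[ R ] a → (a ∧ b) ≋ a → Γ ⊢[ R ] b
  ⊢-up {a} {b} da a∧b≋a =
    ≋-preserves-⊢ (DN-instance ∨-comm ⟨ b ∧ a , b ⟩ ◅◅ DN-instance ∨-absorb ⟨ b , a ⟩)
      (⊢-∨ b (≋-preserves-⊢ (≋-sym a∧b≋a ◅◅ DN-instance ∧-comm ⟨ a , b ⟩) da))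

  isFilter : IsFilter Lindenbaum (Γ ⊢[ R ]_)
  isFilter = record
    { nonempty = ⊤ , app _ r-top var []
    ; up       = ⊢-up
    ; meet     = ⊢-∧
    }

complete : ∀ {Γ φ} → Γ ⊢≤DN φ → Γ ⊢[ R ] φ
complete {Γ} ⊨φ =
  ⊨φ Lindenbaum Lindenbaum-isDN (Γ ⊢[ R ]_) (DerivableFilter.isFilter Γ) id id-isHom (λ _ → hyp)

corollary3p4 : (Γ : Fm → Set) (φ : Fm) →
    (Γ ⊢[ R ] φ → Γ ⊢≤DN φ) × (Γ ⊢≤DN φ → Γ ⊢[ R ] φ)
corollary3p4 Γ φ = sound , complete
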